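{- Let $n\ge 0$ be an integer, let $p,q,x_1,x_2$ be indeterminates, let $\varepsilon=(-1)^n$ in the definition of the modified continuants $K'$, and put $X_3=\dfrac{(-1)^n}{x_2q^2}$. For every integer $j\ge1$, if $$x_3=-x_1\,\frac{1-(-x_1/X_3)^j}{1-(-x_1/X_3)},$$ then $$\frac pq+\frac{(-1)^n}{x_1q^2}\sum_{i=0}^{j}\left(-\frac{X_3}{x_1}\right)^i=\frac pq+\frac{(-1)^nK'(x_2q,x_3q)}{q\,K'(x_1q,x_2q,x_3q)}.$$
   Context: Modified continuants for fixed $\varepsilon=\pm1$: $K'(y_1)=y_1$, $K'(y_1,y_2)=y_1y_2+\varepsilon$, $K'(y_1,y_2,y_3)=K'(y_1,y_2)y_3+\varepsilon y_1$. -}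

module Defs where

open import Data.Nat using (ℕ; zero; suc)
open import Data.Rational using (ℚ; 0ℚ; 1ℚ; _+_; _*_; -_; _÷_; ≢-nonZero)
open import Data.Rational.Properties using (_≟_)
open import Relation.Nullary using (yes; no)

-- Total division on ℚ (x ⊘ 0 = 0); only ever used with nonzero
-- denominators in the statement (nonzeroness is either a hypothesis
-- or follows from the hypotheses).
infixl 7 _⊘_
_⊘_ : ℚ → ℚ → ℚ
x ⊘ y with y ≟ 0ℚ
... | yes _ = 0ℚ
... | no y≢0 = _÷_ x y {{≢-nonZero y≢0}}

infixr 8 _^_
_^_ : ℚ → ℕ → ℚ
x ^ zero = 1ℚ
x ^ suc k = x * (x ^ k)

sgn : ℕ → ℚ
sgn n = (- 1ℚ) ^ n

sumTo : ℕ → (ℕ → ℚ) → ℚ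
sumTo zero f = f zero
sumTo (suc j) f = sumTo j f + f (suc j)

K′₁ : ℚ → ℚ → ℚ
K′₁ ε y₁ = y₁

K′₂ : ℚ → ℚ → ℚ → ℚ
K′₂ ε y₁ y₂ = y₁ * y₂ + ε

K′₃ : ℚ → ℚ → ℚ → ℚ → ℚ
K′₃ ε y₁ y₂ y₃ = K′₂ ε y₁ y₂ * y₃ + ε * y₁

module Submission where

open import Defs
open import Data.List using (_∷_; [])
open import Data.Nat using (ℕ; _≥_; zero; suc)
open import Data.Rational using (ℚ; 0ℚ; 1ℚ; _+_; _-_; _*_; -_; 1/_; ≢-nonZero)
open import Data.Rational.Properties
  using (_≟_; +-*-commutativeRing; 1≢0; *-assoc; *-identityˡ; *-identityʳ; *-zeroˡ; *-zeroʳ; *-inverseˡ; *-inverseʳ)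
open import Relation.Binary.PropositionalEquality
open import Relation.Nullary using (yes; no; contradiction)
open import Relation.Nullary.Decidable using (dec⇒maybe)
open import Tactic.RingSolver using (solve; solve-∀)
open import Tactic.RingSolver.Core.AlmostCommutativeRing using (AlmostCommutativeRing; fromCommutativeRing)

-- Put r = -x₁/X₃, whose reciprocal -X₃/x₁ is the ratio of the geometric sum, and
-- Y = x₂q², so that X₃Y = ε and hence x₁Y = -rε.  Substituting x₃ = -x₁(1 - rʲ)/(1 - r)
-- into the continuants gives  q K′(x₁q, x₂q, x₃q) = εx₁q²rʲ  and
-- (1 - r) ε K′(x₂q, x₃q) = 1 - rʲ⁺¹.  Multiplying the geometric sum by rʲ reverses it,
-- so  rʲ Σᵢ (1/r)ⁱ = (1 - rʲ⁺¹)/(1 - r)  as well, and the two sides agree.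

ℚ-ring : AlmostCommutativeRing _ _
ℚ-ring = fromCommutativeRing +-*-commutativeRing (λ x → dec⇒maybe (0ℚ ≟ x))

*-≡-≢0⇒≢0ˡ : ∀ {x y z} → x * y ≡ z → z ≢ 0ℚ → x ≢ 0ℚ
*-≡-≢0⇒≢0ˡ {y = y} xy≡z z≢0 x≡0 = z≢0 (trans (sym xy≡z) (trans (cong (_* y) x≡0) (*-zeroˡ y)))

*-≡-≢0⇒≢0ʳ : ∀ {x y z} → x * y ≡ z → z ≢ 0ℚ → y ≢ 0ℚ
*-≡-≢0⇒≢0ʳ {x} xy≡z z≢0 y≡0 = z≢0 (trans (sym xy≡z) (trans (cong (x *_) y≡0) (*-zeroʳ x)))

*-cancelʳ-≡ : ∀ {x y z} → z ≢ 0ℚ → x * z ≡ y * z → x ≡ y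
*-cancelʳ-≡ {x} {y} {z} z≢0 xz≡yz = begin
  x                ≡⟨ *-identityʳ x ⟨
  x * 1ℚ           ≡⟨ cong (x *_) (*-inverseʳ z) ⟨
  x * (z * 1/ z)   ≡⟨ *-assoc x z (1/ z) ⟨
  x * z * 1/ z     ≡⟨ cong (_* 1/ z) xz≡yz ⟩
  y * z * 1/ z     ≡⟨ *-assoc y z (1/ z) ⟩
  y * (z * 1/ z)   ≡⟨ cong (y *_) (*-inverseʳ z) ⟩
  y * 1ℚ           ≡⟨ *-identityʳ y ⟩
  y                ∎
  where
  open ≡-Reasoning
  instance _ = ≢-nonZero z≢0

*-≢0 : ∀ {x y} → x ≢ 0ℚ → y ≢ 0ℚ → x * y ≢ 0ℚ
*-≢0 {y = y} x≢0 y≢0 xy≡0 = x≢0 (*-cancelʳ-≡ y≢0 (trans xy≡0 (sym (*-zeroˡ y))))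

^-≢0 : ∀ {x} → x ≢ 0ℚ → ∀ j → x ^ j ≢ 0ℚ
^-≢0 x≢0 zero    = 1≢0
^-≢0 x≢0 (suc j) = *-≢0 x≢0 (^-≢0 x≢0 j)

⊘-*-cancelʳ : ∀ {x y} → y ≢ 0ℚ → (x ⊘ y) * y ≡ x
⊘-*-cancelʳ {x} {y} y≢0 with y ≟ 0ℚ
... | yes y≡0 = contradiction y≡0 y≢0
... | no y≢0′ = begin
  x * 1/ y * y     ≡⟨ *-assoc x (1/ y) y ⟩
  x * (1/ y * y)   ≡⟨ cong (x *_) (*-inverseˡ y) ⟩
  x * 1ℚ           ≡⟨ *-identityʳ x ⟩
  x                ∎
  where
  open ≡-Reasoning
  instance _ = ≢-nonZero y≢0′

*-⊘-cancelʳ : ∀ {x y z} → y ≢ 0ℚ → x * (z ⊘ y) * y ≡ x * z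
*-⊘-cancelʳ {x} {y} {z} y≢0 = trans (*-assoc x (z ⊘ y) y) (cong (x *_) (⊘-*-cancelʳ y≢0))

⊘-*-*-cancel : ∀ {x y z} → y ≢ 0ℚ → (x ⊘ y) * (y * z) ≡ x * z
⊘-*-*-cancel {x} {y} {z} y≢0 = trans (sym (*-assoc (x ⊘ y) y z)) (cong (_* z) (⊘-*-cancelʳ y≢0))

⊘-unique : ∀ {x y z} → y ≢ 0ℚ → z * y ≡ x → x ⊘ y ≡ z
⊘-unique y≢0 zy≡x = *-cancelʳ-≡ y≢0 (trans (⊘-*-cancelʳ y≢0) (sym zy≡x))

neg-⊘-inverse : ∀ {x y} → x ≢ 0ℚ → y ≢ 0ℚ → (- (y ⊘ x)) * (- x ⊘ y) ≡ 1ℚ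
neg-⊘-inverse {x} {y} x≢0 y≢0 = *-cancelʳ-≡ x≢0 (begin
  - (y ⊘ x) * (- x ⊘ y) * x          ≡⟨ regroup (y ⊘ x) (- x ⊘ y) x ⟩
  - ((- x ⊘ y) * ((y ⊘ x) * x))      ≡⟨ cong (λ u → - ((- x ⊘ y) * u)) (⊘-*-cancelʳ x≢0) ⟩
  - ((- x ⊘ y) * y)                  ≡⟨ cong -_ (⊘-*-cancelʳ y≢0) ⟩
  - (- x)                            ≡⟨ solve (x ∷ []) ℚ-ring ⟩
  1ℚ * x                             ∎)
  where
  open ≡-Reasoning
  regroup : ∀ a b c → - a * b * c ≡ - (b * (a * c))
  regroup = solve-∀ ℚ-ring

sgn*sgn≡1 : ∀ n → sgn n * sgn n ≡ 1ℚ
sgn*sgn≡1 zero    = refl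
sgn*sgn≡1 (suc n) = trans (square (sgn n)) (sgn*sgn≡1 n)
  where
  square : ∀ s → (- 1ℚ) * s * ((- 1ℚ) * s) ≡ s * s
  square = solve-∀ ℚ-ring

^-*-inverse : ∀ {t r} → t * r ≡ 1ℚ → ∀ j → t ^ j * r ^ j ≡ 1ℚ
^-*-inverse tr≡1 zero              = refl
^-*-inverse {t} {r} tr≡1 (suc j) = begin
  t * t ^ j * (r * r ^ j)       ≡⟨ regroup t (t ^ j) r (r ^ j) ⟩
  t * r * (t ^ j * r ^ j)       ≡⟨ cong₂ _*_ tr≡1 (^-*-inverse tr≡1 j) ⟩
  1ℚ                            ∎
  where
  open ≡-Reasoning
  regroup : ∀ a b c d → a * b * (c * d) ≡ a * c * (b * d)
  regroup = solve-∀ ℚ-ring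

sumTo-reciprocal-geometric : ∀ {t r} → t * r ≡ 1ℚ → ∀ j →
  sumTo j (t ^_) * r ^ j * (1ℚ - r) ≡ 1ℚ - r ^ suc j
sumTo-reciprocal-geometric {t} {r} tr≡1 zero = base r
  where
  base : ∀ c → 1ℚ * 1ℚ * (1ℚ - c) ≡ 1ℚ - c * 1ℚ
  base = solve-∀ ℚ-ring
sumTo-reciprocal-geometric {t} {r} tr≡1 (suc j) = begin
  (S + t * t ^ j) * (r * r ^ j) * (1ℚ - r)
    ≡⟨ regroup S t (t ^ j) r (r ^ j) ⟩
  r * (S * r ^ j * (1ℚ - r)) + t * r * (t ^ j * r ^ j) * (1ℚ - r)
    ≡⟨ cong₂ (λ u v → r * u + v * (1ℚ - r))
             (sumTo-reciprocal-geometric tr≡1 j) (cong₂ _*_ tr≡1 (^-*-inverse tr≡1 j)) ⟩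
  r * (1ℚ - r * r ^ j) + 1ℚ * 1ℚ * (1ℚ - r)
    ≡⟨ collapse r (r ^ j) ⟩
  1ℚ - r * (r * r ^ j)
    ∎
  where
  open ≡-Reasoning
  S = sumTo j (t ^_)
  regroup : ∀ s a b c d → (s + a * b) * (c * d) * (1ℚ - c)
                        ≡ c * (s * d * (1ℚ - c)) + a * c * (b * d) * (1ℚ - c)
  regroup = solve-∀ ℚ-ring
  collapse : ∀ c d → c * (1ℚ - c * d) + 1ℚ * 1ℚ * (1ℚ - c) ≡ 1ℚ - c * (c * d)
  collapse = solve-∀ ℚ-ring

K′₃-value : ∀ ε q x₁ x₂ x₃ r ρ →
  r * ε ≡ - x₁ * (x₂ * q * q) → x₃ * (1ℚ - r) ≡ - x₁ * (1ℚ - ρ) →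
  q * K′₃ ε (x₁ * q) (x₂ * q) (x₃ * q) ≡ ε * x₁ * q * q * ρ
K′₃-value ε q x₁ x₂ x₃ r ρ r*ε≡ x₃[1-r]≡ = begin
  q * K′₃ ε (x₁ * q) (x₂ * q) (x₃ * q)                    ≡⟨⟩
  q * ((x₁ * q * (x₂ * q) + ε) * (x₃ * q) + ε * (x₁ * q))  ≡⟨ solve (ε ∷ q ∷ x₁ ∷ x₂ ∷ x₃ ∷ []) ℚ-ring ⟩
  q * q * (ε * (x₃ + x₁) - - x₁ * (x₂ * q * q) * x₃)      ≡⟨ cong (λ u → q * q * (ε * (x₃ + x₁) - u * x₃)) r*ε≡ ⟨
  q * q * (ε * (x₃ + x₁) - r * ε * x₃)                    ≡⟨ solve (ε ∷ q ∷ x₁ ∷ x₃ ∷ r ∷ []) ℚ-ring ⟩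
  ε * q * q * (x₃ * (1ℚ - r) + x₁)                        ≡⟨ cong (λ u → ε * q * q * (u + x₁)) x₃[1-r]≡ ⟩
  ε * q * q * (- x₁ * (1ℚ - ρ) + x₁)                      ≡⟨ solve (ε ∷ q ∷ x₁ ∷ ρ ∷ []) ℚ-ring ⟩
  ε * x₁ * q * q * ρ                                      ∎
  where open ≡-Reasoning

K′₂-value : ∀ ε q x₁ x₂ x₃ r ρ → ε * ε ≡ 1ℚ →
  r * ε ≡ - x₁ * (x₂ * q * q) → x₃ * (1ℚ - r) ≡ - x₁ * (1ℚ - ρ) →
  ε * K′₂ ε (x₂ * q) (x₃ * q) * (1ℚ - r) ≡ 1ℚ - r * ρ
K′₂-value ε q x₁ x₂ x₃ r ρ εε≡1 r*ε≡ x₃[1-r]≡ = begin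
  ε * K′₂ ε (x₂ * q) (x₃ * q) * (1ℚ - r)                 ≡⟨⟩
  ε * (x₂ * q * (x₃ * q) + ε) * (1ℚ - r)                 ≡⟨ solve (ε ∷ q ∷ x₂ ∷ x₃ ∷ r ∷ []) ℚ-ring ⟩
  ε * ε * (1ℚ - r) + ε * (x₂ * q * q) * (x₃ * (1ℚ - r))  ≡⟨ cong (λ u → ε * ε * (1ℚ - r) + ε * (x₂ * q * q) * u) x₃[1-r]≡ ⟩
  ε * ε * (1ℚ - r) + ε * (x₂ * q * q) * (- x₁ * (1ℚ - ρ)) ≡⟨ solve (ε ∷ q ∷ x₁ ∷ x₂ ∷ r ∷ ρ ∷ []) ℚ-ring ⟩
  ε * ε * (1ℚ - r) + ε * (- x₁ * (x₂ * q * q)) * (1ℚ - ρ) ≡⟨ cong (λ u → ε * ε * (1ℚ - r) + ε * u * (1ℚ - ρ)) r*ε≡ ⟨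
  ε * ε * (1ℚ - r) + ε * (r * ε) * (1ℚ - ρ)              ≡⟨ solve (ε ∷ r ∷ ρ ∷ []) ℚ-ring ⟩
  ε * ε * (1ℚ - r * ρ)                                   ≡⟨ cong (_* (1ℚ - r * ρ)) εε≡1 ⟩
  1ℚ * (1ℚ - r * ρ)                                      ≡⟨ *-identityˡ (1ℚ - r * ρ) ⟩
  1ℚ - r * ρ                                             ∎
  where open ≡-Reasoning

continuant-ratio : ∀ ε q x₁ x₂ x₃ r t j → ε * ε ≡ 1ℚ → t * r ≡ 1ℚ →
  q ≢ 0ℚ → x₁ ≢ 0ℚ → 1ℚ - r ≢ 0ℚ →
  r * ε ≡ - x₁ * (x₂ * q * q) → x₃ * (1ℚ - r) ≡ - x₁ * (1ℚ - r ^ j) →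
  (ε ⊘ (x₁ * q * q)) * sumTo j (t ^_)
    ≡ (ε * K′₂ ε (x₂ * q) (x₃ * q)) ⊘ (q * K′₃ ε (x₁ * q) (x₂ * q) (x₃ * q))
continuant-ratio ε q x₁ x₂ x₃ r t j εε≡1 tr≡1 q≢0 x₁≢0 1-r≢0 r*ε≡ x₃[1-r]≡ =
  sym (⊘-unique M≢0 (begin
    e * S * M                          ≡⟨ cong (e * S *_) M≡ ⟩
    e * S * (ε * x₁ * q * q * r ^ j)   ≡⟨ regroup e S ε x₁ q (r ^ j) ⟩
    e * (x₁ * q * q) * ε * (S * r ^ j) ≡⟨ cong₂ (λ u v → u * ε * v) (⊘-*-cancelʳ x₁qq≢0) S*rʲ≡N ⟩
    ε * ε * N                          ≡⟨ cong (_* N) εε≡1 ⟩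
    1ℚ * N                             ≡⟨ *-identityˡ N ⟩
    N                                  ∎))
  where
  open ≡-Reasoning
  e = ε ⊘ (x₁ * q * q)
  S = sumTo j (t ^_)
  M = q * K′₃ ε (x₁ * q) (x₂ * q) (x₃ * q)
  N = ε * K′₂ ε (x₂ * q) (x₃ * q)
  x₁qq≢0 : x₁ * q * q ≢ 0ℚ
  x₁qq≢0 = *-≢0 (*-≢0 x₁≢0 q≢0) q≢0
  M≡ : M ≡ ε * x₁ * q * q * r ^ j
  M≡ = K′₃-value ε q x₁ x₂ x₃ r (r ^ j) r*ε≡ x₃[1-r]≡
  ε≢0 : ε ≢ 0ℚ
  ε≢0 = *-≡-≢0⇒≢0ˡ εε≡1 1≢0
  r≢0 : r ≢ 0ℚ
  r≢0 = *-≡-≢0⇒≢0ʳ {x = t} tr≡1 1≢0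
  M≢0 : M ≢ 0ℚ
  M≢0 = subst (_≢ 0ℚ) (sym M≡) (*-≢0 (*-≢0 (*-≢0 (*-≢0 ε≢0 x₁≢0) q≢0) q≢0) (^-≢0 r≢0 j))
  S*rʲ≡N : S * r ^ j ≡ N
  S*rʲ≡N = *-cancelʳ-≡ 1-r≢0 (trans (sumTo-reciprocal-geometric tr≡1 j)
             (sym (K′₂-value ε q x₁ x₂ x₃ r (r ^ j) εε≡1 r*ε≡ x₃[1-r]≡)))
  regroup : ∀ a b c d f g → a * b * (c * d * f * f * g) ≡ a * (d * f * f) * c * (b * g)
  regroup = solve-∀ ℚ-ring

proposition5p1 : (n : ℕ) (j : ℕ) → j ≥ 1 →
    (p q x₁ x₂ x₃ X₃ : ℚ) →
    q ≢ 0ℚ → x₁ ≢ 0ℚ → x₂ ≢ 0ℚ →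
    X₃ ≡ sgn n ⊘ (x₂ * q * q) →
    1ℚ - (- x₁ ⊘ X₃) ≢ 0ℚ →
    x₃ ≡ - x₁ * ((1ℚ - (- x₁ ⊘ X₃) ^ j) ⊘ (1ℚ - (- x₁ ⊘ X₃))) →
    p ⊘ q + (sgn n ⊘ (x₁ * q * q)) * sumTo j (λ i → (- (X₃ ⊘ x₁)) ^ i)
      ≡ p ⊘ q + (sgn n * K′₂ (sgn n) (x₂ * q) (x₃ * q))
                ⊘ (q * K′₃ (sgn n) (x₁ * q) (x₂ * q) (x₃ * q))
proposition5p1 n j _ p q x₁ x₂ x₃ X₃ q≢0 x₁≢0 x₂≢0 X₃≡ 1-r≢0 x₃≡ =
  cong (p ⊘ q +_) (continuant-ratio ε q x₁ x₂ x₃ r (- (X₃ ⊘ x₁)) j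
                     (sgn*sgn≡1 n) (neg-⊘-inverse x₁≢0 X₃≢0) q≢0 x₁≢0 1-r≢0 r*ε≡ x₃[1-r]≡)
  where
  ε = sgn n
  r = - x₁ ⊘ X₃
  X₃*Y≡ε : X₃ * (x₂ * q * q) ≡ ε
  X₃*Y≡ε = trans (cong (_* (x₂ * q * q)) X₃≡) (⊘-*-cancelʳ (*-≢0 (*-≢0 x₂≢0 q≢0) q≢0))
  X₃≢0 : X₃ ≢ 0ℚ
  X₃≢0 = *-≡-≢0⇒≢0ˡ X₃*Y≡ε (*-≡-≢0⇒≢0ˡ {y = ε} (sgn*sgn≡1 n) 1≢0)
  r*ε≡ : r * ε ≡ - x₁ * (x₂ * q * q)
  r*ε≡ = trans (cong (r *_) (sym X₃*Y≡ε)) (⊘-*-*-cancel X₃≢0)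
  x₃[1-r]≡ : x₃ * (1ℚ - r) ≡ - x₁ * (1ℚ - r ^ j)
  x₃[1-r]≡ = trans (cong (_* (1ℚ - r)) x₃≡) (*-⊘-cancelʳ {x = - x₁} 1-r≢0)
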